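{- Let $\delta\in(0,1)$, let $\mathcal{C}:\{\pm1\}^k\to\{\pm1\}^n$ be a $(3,\delta)$-strong LDC with triple sets $M_1,\dots,M_k$, and let $G$ be its signature graph. Let $x$ be a vertex of $G$, let $E(x)$ be the set of edges of $G$ incident to $x$, and let $\mathcal{S}\subseteq[k]$ be a set of colors. Let $E(x,\mathcal{S})=\{e\in E(x):\ \mathsf{col}(e)\cap\mathcal{S}\neq\emptyset\}$. Then $|E(x,\mathcal{S})|\le 4|\mathcal{S}|$.
   Context: A $(3,\delta)$-strong LDC is a map $\mathcal{C}:\{\pm1\}^k\to\{\pm1\}^n$ such that for every $i\in[k]$ there is a set $M_i$ of at least $\delta n$ pairwise disjoint $3$-element subsets of $[n]$ with $x_i=\mathcal{C}(x)_{j_1}\mathcal{C}(x)_{j_2}\mathcal{C}(x)_{j_3}$ for all $x\in\{\pm1\}^k$ and all $\{j_1,j_2,j_3\}\in M_i$; moreover for $i\ne i'$ a triple of $M_i$ and a triple of $M_{i'}$ share at most one element. The recovery hypergraph $H$ has vertex set $[n]$ and edge set $\bigcup_i M_i$, a hyperedge in $M_i$ having color $i$; $H$ is linear. The signature graph $G$ has vertex set $\{(u,v): u,v\in[n],\ u\neq v\}$, and $(u_1,v_1),(u_2,v_2)$ are adjacent iff $\{u_1,v_1\}\cap\{u_2,v_2\}=\emptyset$ and there is $w\in[n]$ with $\{u_1,u_2,w\},\{v_1,v_2,w\}\in E(H)$ (such $w$ is unique by linearity). For such an edge $e$, $\mathsf{col}(e)=\{i_1,i_2\}$ where $\{u_1,u_2,w\}\in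 M_{i_1}$ and $\{v_1,v_2,w\}\in M_{i_2}$. -}

module Defs where

open import Data.Nat using (ℕ; _≤_)
open import Data.Integer using (+_)
open import Data.Fin using (Fin)
open import Data.Fin.Subset using (Subset; ⁅_⁆; _∪_; _∩_; ∣_∣; Empty)
  renaming (_∈_ to _∈ₛ_)
open import Data.Sign using (Sign) renaming (_*_ to _*ₛ_)
open import Data.Rational using (ℚ; _/_) renaming (_≤_ to _≤ℚ_; _*_ to _*ℚ_)
open import Data.List using (List; length)
open import Data.List.Membership.Propositional using (_∈_)
open import Data.List.Relation.Unary.AllPairs using (AllPairs)
open import Data.Product using (Σ; ∃; ∃-syntax; _×_; _,_)
open import Data.Sum using (_⊎_)
open import Relation.Binary.PropositionalEquality using (_≡_; _≢_)

-- ±1 is modelled by Data.Sign.Sign (with its multiplication).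
-- A "3-element subset of [n]" is a Subset n of cardinality 3.

⟪_,_,_⟫ : ∀ {n} → Fin n → Fin n → Fin n → Subset n
⟪ a , b , c ⟫ = ⁅ a ⁆ ∪ (⁅ b ⁆ ∪ ⁅ c ⁆)

ℕ→ℚ : ℕ → ℚ
ℕ→ℚ m = (+ m) / 1

record IsStrongLDC (k n : ℕ) (δ : ℚ)
                   (C : (Fin k → Sign) → (Fin n → Sign))
                   (M : Fin k → List (Subset n)) : Set where
  field
    triple     : ∀ i t → t ∈ M i → ∣ t ∣ ≡ 3
    -- the triples of M i are pairwise disjoint (as a list: distinct positions
    -- hold disjoint triples, so in particular there are no repetitions)
    disjoint   : ∀ i → AllPairs (λ s t → Empty (s ∩ t)) (M i)
    large      : ∀ i → (δ *ℚ ℕ→ℚ n) ≤ℚ ℕ→ℚ (length (M i))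
    decode     : ∀ (x : Fin k → Sign) i t → t ∈ M i →
                 ∀ j₁ j₂ j₃ → j₁ ≢ j₂ → j₁ ≢ j₃ → j₂ ≢ j₃ →
                 j₁ ∈ₛ t → j₂ ∈ₛ t → j₃ ∈ₛ t →
                 x i ≡ (C x j₁ *ₛ C x j₂) *ₛ C x j₃
    cross      : ∀ i i' s t → i ≢ i' → s ∈ M i → t ∈ M i' → ∣ s ∩ t ∣ ≤ 1

IsSigVertex : ∀ {n} → Fin n × Fin n → Set
IsSigVertex (u , v) = u ≢ v

PairsDisjoint : ∀ {n} → Fin n × Fin n → Fin n × Fin n → Set
PairsDisjoint (u₁ , v₁) (u₂ , v₂) = u₁ ≢ u₂ × u₁ ≢ v₂ × v₁ ≢ u₂ × v₁ ≢ v₂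

-- w witnesses the edge (u₁,v₁)—(u₂,v₂) with {u₁,u₂,w} ∈ M i₁, {v₁,v₂,w} ∈ M i₂
-- (so col of that edge is {i₁, i₂}; by linearity w, i₁, i₂ are unique).
EdgeVia : ∀ {k n} → (Fin k → List (Subset n)) →
          Fin n × Fin n → Fin n × Fin n → Fin n → Fin k → Fin k → Set
EdgeVia M (u₁ , v₁) (u₂ , v₂) w i₁ i₂ =
  ⟪ u₁ , u₂ , w ⟫ ∈ M i₁ × ⟪ v₁ , v₂ , w ⟫ ∈ M i₂

SigAdj : ∀ {k n} → (Fin k → List (Subset n)) → Fin n × Fin n → Fin n × Fin n → Set
SigAdj M x y = PairsDisjoint x y × ∃[ w ] ∃[ i₁ ] ∃[ i₂ ] EdgeVia M x y w i₁ i₂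

-- y is the other endpoint of an edge e ∈ E(x, S), i.e. e = {x, y} ∈ E(G)
-- and col(e) ∩ S ≠ ∅.
InES : ∀ {k n} → (Fin k → List (Subset n)) → Subset k →
       Fin n × Fin n → Fin n × Fin n → Set
InES M S x y = IsSigVertex y × PairsDisjoint x y ×
  ∃[ w ] ∃[ i₁ ] ∃[ i₂ ] (EdgeVia M x y w i₁ i₂ × (i₁ ∈ₛ S ⊎ i₂ ∈ₛ S))

-- Fix x = (u , v). An edge of G from x to y = (u′ , v′) via w consists of triples
-- {u, u′, w} and {v, v′, w}. Since H is linear, w determines y: the only triple
-- through u and w fixes u′, and likewise for v′. If the edge has a colour i ∈ S,
-- then w lies in the link of u or of v in the colour class M i, i.e. in the unique
-- triple of M i through that vertex, minus the vertex itself; the two links have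
-- at most 2 elements each. So w ranges over a set of size at most 4 |S|.
module Submission where

open import Defs
open import Data.Nat using (ℕ; _≤_; _<_; _*_; _+_; z≤n; s≤s)
open import Data.Nat.Properties using (module ≤-Reasoning; ≤-trans; +-mono-≤; +-monoʳ-≤; +-suc; *-suc; n≤1+n; ≤-pred)
open import Data.Fin using (Fin; zero; suc)
open import Data.Fin.Properties using (_≟_)
open import Data.Fin.Subset using (Subset; ∣_∣; ⁅_⁆; _∪_; _∩_; _-_; ⊥; inside; outside; Empty)
  renaming (_∈_ to _∈ₛ_; _⊆_ to _⊆ₛ_)
open import Data.Fin.Subset.Properties
  using (x∈⁅x⁆; x∈⁅y⁆⇒x≡y; ∣⁅x⁆∣≡1; ∣⊥∣≡0; x∈p∩q⁺; x∈p∪q⁻; x∈p∪q⁺; p⊆q⇒∣p∣≤∣q∣;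
         x∈p∧x≢y⇒x∈p-y; x∈p⇒∣p-x∣<∣p∣; _∈?_)
open import Data.Sign using (Sign)
open import Data.Rational using (ℚ; 0ℚ; 1ℚ) renaming (_<_ to _<ℚ_)
open import Data.List using (List; []; _∷_; length)
open import Data.List.Membership.Propositional using (_∈_)
open import Data.List.Relation.Unary.Any using (here; there)
open import Data.List.Relation.Unary.All using (All; []; _∷_; lookup; tabulate)
open import Data.List.Relation.Unary.AllPairs using (AllPairs; []; _∷_)
open import Data.List.Relation.Unary.Unique.Propositional using (Unique)
open import Data.Product using (_×_; _,_)
open import Data.Sum using (_⊎_; inj₁; inj₂)
open import Data.Vec using ([]; _∷_) renaming (here to hereᵥ; there to thereᵥ)
open import Data.Empty using (⊥-elim)
open import Function using (_∘′_)
open import Relation.Nullary using (yes; no; contradiction)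
open import Relation.Binary.PropositionalEquality using (_≡_; _≢_; refl; sym; cong₂; subst)

private
  variable
    k n : ℕ
    a b b′ c d : Fin n
    p s t : Subset n
    ts : List (Subset n)

∣p∪q∣≤∣p∣+∣q∣ : (p q : Subset n) → ∣ p ∪ q ∣ ≤ ∣ p ∣ + ∣ q ∣
∣p∪q∣≤∣p∣+∣q∣ [] [] = z≤n
∣p∪q∣≤∣p∣+∣q∣ (inside ∷ p) (inside ∷ q) =
  s≤s (≤-trans (∣p∪q∣≤∣p∣+∣q∣ p q) (+-monoʳ-≤ ∣ p ∣ (n≤1+n ∣ q ∣)))
∣p∪q∣≤∣p∣+∣q∣ (inside ∷ p) (outside ∷ q) = s≤s (∣p∪q∣≤∣p∣+∣q∣ p q)
∣p∪q∣≤∣p∣+∣q∣ (outside ∷ p) (inside ∷ q) =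
  subst (∣ p ∪ q ∣ <_) (sym (+-suc ∣ p ∣ ∣ q ∣)) (s≤s (∣p∪q∣≤∣p∣+∣q∣ p q))
∣p∪q∣≤∣p∣+∣q∣ (outside ∷ p) (outside ∷ q) = ∣p∪q∣≤∣p∣+∣q∣ p q

x∈p∧y∈p∧x≢y⇒2≤∣p∣ : a ∈ₛ p → b ∈ₛ p → a ≢ b → 2 ≤ ∣ p ∣
x∈p∧y∈p∧x≢y⇒2≤∣p∣ a∈p b∈p a≢b =
  ≤-trans (s≤s (≤-trans (s≤s z≤n) (x∈p⇒∣p-x∣<∣p∣ (x∈p∧x≢y⇒x∈p-y b∈p (a≢b ∘′ sym)))))
          (x∈p⇒∣p-x∣<∣p∣ a∈p)

∈⟪⟫⁻ : d ∈ₛ ⟪ a , b , c ⟫ → d ≡ a ⊎ d ≡ b ⊎ d ≡ c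
∈⟪⟫⁻ {a = a} {b} {c} d∈ with x∈p∪q⁻ ⁅ a ⁆ (⁅ b ⁆ ∪ ⁅ c ⁆) d∈
... | inj₁ d∈a = inj₁ (x∈⁅y⁆⇒x≡y a d∈a)
... | inj₂ d∈bc with x∈p∪q⁻ ⁅ b ⁆ ⁅ c ⁆ d∈bc
...   | inj₁ d∈b = inj₂ (inj₁ (x∈⁅y⁆⇒x≡y b d∈b))
...   | inj₂ d∈c = inj₂ (inj₂ (x∈⁅y⁆⇒x≡y c d∈c))

∈⟪⟫₁ : a ∈ₛ ⟪ a , b , c ⟫
∈⟪⟫₁ = x∈p∪q⁺ (inj₁ (x∈⁅x⁆ _))

∈⟪⟫₂ : b ∈ₛ ⟪ a , b , c ⟫
∈⟪⟫₂ = x∈p∪q⁺ (inj₂ (x∈p∪q⁺ (inj₁ (x∈⁅x⁆ _))))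

∈⟪⟫₃ : c ∈ₛ ⟪ a , b , c ⟫
∈⟪⟫₃ = x∈p∪q⁺ (inj₂ (x∈p∪q⁺ (inj₂ (x∈⁅x⁆ _))))

c∈⁅a⁆∪⁅b⁆⇒∣⟪a,b,c⟫∣≤2 : c ∈ₛ ⁅ a ⁆ ∪ ⁅ b ⁆ → ∣ ⟪ a , b , c ⟫ ∣ ≤ 2
c∈⁅a⁆∪⁅b⁆⇒∣⟪a,b,c⟫∣≤2 {c = c} {a} {b} c∈ab = begin
  ∣ ⟪ a , b , c ⟫ ∣       ≤⟨ p⊆q⇒∣p∣≤∣q∣ ⟪a,b,c⟫⊆⁅a⁆∪⁅b⁆ ⟩
  ∣ ⁅ a ⁆ ∪ ⁅ b ⁆ ∣       ≤⟨ ∣p∪q∣≤∣p∣+∣q∣ ⁅ a ⁆ ⁅ b ⁆ ⟩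
  ∣ ⁅ a ⁆ ∣ + ∣ ⁅ b ⁆ ∣   ≡⟨ cong₂ _+_ (∣⁅x⁆∣≡1 a) (∣⁅x⁆∣≡1 b) ⟩
  2                       ∎
  where
  open ≤-Reasoning
  ⟪a,b,c⟫⊆⁅a⁆∪⁅b⁆ : ⟪ a , b , c ⟫ ⊆ₛ ⁅ a ⁆ ∪ ⁅ b ⁆
  ⟪a,b,c⟫⊆⁅a⁆∪⁅b⁆ x∈ with ∈⟪⟫⁻ x∈
  ... | inj₁ refl = x∈p∪q⁺ (inj₁ (x∈⁅x⁆ a))
  ... | inj₂ (inj₁ refl) = x∈p∪q⁺ (inj₂ (x∈⁅x⁆ b))
  ... | inj₂ (inj₂ refl) = c∈ab

∣⟪a,b,c⟫∣≡3⇒a≢c : ∣ ⟪ a , b , c ⟫ ∣ ≡ 3 → a ≢ c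
∣⟪a,b,c⟫∣≡3⇒a≢c {a = a} {b} ∣t∣≡3 refl
  with subst (_≤ 2) ∣t∣≡3 (c∈⁅a⁆∪⁅b⁆⇒∣⟪a,b,c⟫∣≤2 {a = a} {b} (x∈p∪q⁺ (inj₁ (x∈⁅x⁆ a))))
... | s≤s (s≤s ())

∣⟪a,b,c⟫∣≡3⇒b≢c : ∣ ⟪ a , b , c ⟫ ∣ ≡ 3 → b ≢ c
∣⟪a,b,c⟫∣≡3⇒b≢c {a = a} {b} ∣t∣≡3 refl
  with subst (_≤ 2) ∣t∣≡3 (c∈⁅a⁆∪⁅b⁆⇒∣⟪a,b,c⟫∣≤2 {a = a} {b} (x∈p∪q⁺ (inj₂ (x∈⁅x⁆ b))))
... | s≤s (s≤s ())

PairwiseDisjoint : List (Subset n) → Set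
PairwiseDisjoint = AllPairs (λ s t → Empty (s ∩ t))

meet-in-PairwiseDisjoint⇒≡ : PairwiseDisjoint ts → s ∈ ts → t ∈ ts → a ∈ₛ s → a ∈ₛ t → s ≡ t
meet-in-PairwiseDisjoint⇒≡ (_ ∷ _) (here refl) (here refl) _ _ = refl
meet-in-PairwiseDisjoint⇒≡ {a = a} (s∩ ∷ _) (here refl) (there t∈) a∈s a∈t =
  ⊥-elim (lookup s∩ t∈ (a , x∈p∩q⁺ (a∈s , a∈t)))
meet-in-PairwiseDisjoint⇒≡ {a = a} (t∩ ∷ _) (there s∈) (here refl) a∈s a∈t =
  ⊥-elim (lookup t∩ s∈ (a , x∈p∩q⁺ (a∈t , a∈s)))
meet-in-PairwiseDisjoint⇒≡ (_ ∷ disj) (there s∈) (there t∈) a∈s a∈t =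
  meet-in-PairwiseDisjoint⇒≡ disj s∈ t∈ a∈s a∈t

-- ⊥ when no member of ts contains a.
link : Fin n → List (Subset n) → Subset n
link a [] = ⊥
link a (t ∷ ts) with a ∈? t
... | yes _ = t - a
... | no _ = link a ts

∣link∣≤2 : (a : Fin n) → All (λ t → ∣ t ∣ ≡ 3) ts → ∣ link a ts ∣ ≤ 2
∣link∣≤2 {n} a [] = subst (_≤ 2) (sym (∣⊥∣≡0 n)) z≤n
∣link∣≤2 {ts = t ∷ ts} a (∣t∣≡3 ∷ sizes) with a ∈? t
... | yes a∈t = ≤-pred (subst (∣ t - a ∣ <_) ∣t∣≡3 (x∈p⇒∣p-x∣<∣p∣ a∈t))
... | no _ = ∣link∣≤2 a sizes

∈link : PairwiseDisjoint ts → t ∈ ts → a ∈ₛ t → b ∈ₛ t → b ≢ a → b ∈ₛ link a ts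
∈link {ts = s ∷ ts} {a = a} (s∩ ∷ disj) t∈ a∈t b∈t b≢a with a ∈? s | t∈
... | yes _   | here refl  = x∈p∧x≢y⇒x∈p-y b∈t b≢a
... | yes a∈s | there t∈ts = ⊥-elim (lookup s∩ t∈ts (a , x∈p∩q⁺ (a∈s , a∈t)))
... | no a∉s  | here refl  = contradiction a∈t a∉s
... | no _    | there t∈ts = ∈link disj t∈ts a∈t b∈t b≢a

⋃[_]_ : Subset k → (Fin k → Subset n) → Subset n
⋃[ [] ] f = ⊥
⋃[ inside ∷ S ] f = f zero ∪ ⋃[ S ] (f ∘′ suc)
⋃[ outside ∷ S ] f = ⋃[ S ] (f ∘′ suc)

∣⋃[S]f∣≤m*∣S∣ : (m : ℕ) (S : Subset k) (f : Fin k → Subset n) →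
                (∀ i → ∣ f i ∣ ≤ m) → ∣ ⋃[ S ] f ∣ ≤ m * ∣ S ∣
∣⋃[S]f∣≤m*∣S∣ {n = n} m [] f _ = subst (_≤ m * 0) (sym (∣⊥∣≡0 n)) z≤n
∣⋃[S]f∣≤m*∣S∣ m (inside ∷ S) f ∣f∣≤m = begin
  ∣ f zero ∪ ⋃[ S ] (f ∘′ suc) ∣        ≤⟨ ∣p∪q∣≤∣p∣+∣q∣ (f zero) _ ⟩
  ∣ f zero ∣ + ∣ ⋃[ S ] (f ∘′ suc) ∣    ≤⟨ +-mono-≤ (∣f∣≤m zero) (∣⋃[S]f∣≤m*∣S∣ m S _ (λ i → ∣f∣≤m (suc i))) ⟩
  m + m * ∣ S ∣                         ≡⟨ *-suc m ∣ S ∣ ⟨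
  m * (1 + ∣ S ∣)                       ∎
  where open ≤-Reasoning
∣⋃[S]f∣≤m*∣S∣ m (outside ∷ S) f ∣f∣≤m = ∣⋃[S]f∣≤m*∣S∣ m S _ (λ i → ∣f∣≤m (suc i))

x∈f[i]⇒x∈⋃[S]f : {i : Fin k} (S : Subset k) (f : Fin k → Subset n) → i ∈ₛ S → a ∈ₛ f i → a ∈ₛ ⋃[ S ] f
x∈f[i]⇒x∈⋃[S]f (inside ∷ S) f hereᵥ a∈ = x∈p∪q⁺ (inj₁ a∈)
x∈f[i]⇒x∈⋃[S]f (inside ∷ S) f (thereᵥ i∈S) a∈ = x∈p∪q⁺ (inj₂ (x∈f[i]⇒x∈⋃[S]f S _ i∈S a∈))
x∈f[i]⇒x∈⋃[S]f (outside ∷ S) f (thereᵥ i∈S) a∈ = x∈f[i]⇒x∈⋃[S]f S _ i∈S a∈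

module _ {A : Set} {P : A → Set} (label : ∀ {y} → P y → Fin n)
         (label-injective : ∀ {y y′} (p : P y) (p′ : P y′) → label p ≡ label p′ → y ≡ y′) where

  Unique⇒length≤∣labels∣ : ∀ {ys} (T : Subset n) → Unique ys → All P ys →
                            (∀ {y} → y ∈ ys → (p : P y) → label p ∈ₛ T) → length ys ≤ ∣ T ∣
  Unique⇒length≤∣labels∣ T [] [] _ = z≤n
  Unique⇒length≤∣labels∣ {ys = y ∷ ys} T (y∉ys ∷ unique) (p ∷ ps) labels∈T =
    ≤-trans (s≤s (Unique⇒length≤∣labels∣ (T - label p) unique ps labels∈T-p))
            (x∈p⇒∣p-x∣<∣p∣ (labels∈T (here refl) p))
    where
    labels∈T-p : ∀ {y′} → y′ ∈ ys → (p′ : P y′) → label p′ ∈ₛ T - label p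
    labels∈T-p y′∈ys p′ = x∈p∧x≢y⇒x∈p-y (labels∈T (there y′∈ys) p′)
                                         (lookup y∉ys y′∈ys ∘′ sym ∘′ label-injective p′ p)

module StrongLDC {k n : ℕ} {δ : ℚ} {C : (Fin k → Sign) → (Fin n → Sign)} {M : Fin k → List (Subset n)}
                 (ldc : IsStrongLDC k n δ C M) where
  open IsStrongLDC ldc

  private
    variable
      i i′ : Fin k

  H-linear : s ∈ M i → t ∈ M i′ → a ∈ₛ s → b ∈ₛ s → a ∈ₛ t → b ∈ₛ t → a ≢ b → s ≡ t
  H-linear {i = i} {i′ = i′} s∈ t∈ a∈s b∈s a∈t b∈t a≢b with i ≟ i′
  ... | yes refl = meet-in-PairwiseDisjoint⇒≡ (disjoint i) s∈ t∈ a∈s a∈t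
  ... | no i≢i′ with ≤-trans (x∈p∧y∈p∧x≢y⇒2≤∣p∣ (x∈p∩q⁺ (a∈s , a∈t)) (x∈p∩q⁺ (b∈s , b∈t)) a≢b)
                             (cross i i′ _ _ i≢i′ s∈ t∈)
  ...   | s≤s ()

  ⟪a,b,w⟫∈H⇒b-unique : {w : Fin n} → ⟪ a , b , w ⟫ ∈ M i → ⟪ a , b′ , w ⟫ ∈ M i′ → a ≢ b → b ≡ b′
  ⟪a,b,w⟫∈H⇒b-unique {a = a} {b} {i = i} t∈ t′∈ a≢b
    with ∈⟪⟫⁻ (subst (b ∈ₛ_) (H-linear t∈ t′∈ ∈⟪⟫₁ ∈⟪⟫₃ ∈⟪⟫₁ ∈⟪⟫₃ (∣⟪a,b,c⟫∣≡3⇒a≢c ∣t∣≡3)) ∈⟪⟫₂)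
    where ∣t∣≡3 = triple i _ t∈
  ... | inj₁ b≡a = contradiction (sym b≡a) a≢b
  ... | inj₂ (inj₁ b≡b′) = b≡b′
  ... | inj₂ (inj₂ b≡w) = contradiction b≡w (∣⟪a,b,c⟫∣≡3⇒b≢c {a = a} (triple i _ t∈))

  ⟪a,b,c⟫∈M[i]⇒c∈link : ⟪ a , b , c ⟫ ∈ M i → c ∈ₛ link a (M i)
  ⟪a,b,c⟫∈M[i]⇒c∈link {i = i} t∈ =
    ∈link (disjoint i) t∈ ∈⟪⟫₁ ∈⟪⟫₃ (∣⟪a,b,c⟫∣≡3⇒a≢c (triple i _ t∈) ∘′ sym)

  module _ (u v : Fin n) (S : Subset k) where

    meetingVertex : ∀ {y} → InES M S (u , v) y → Fin n
    meetingVertex (_ , _ , w , _) = w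

    meetingVertex-injective : ∀ {y y′} (e : InES M S (u , v) y) (e′ : InES M S (u , v) y′) →
                              meetingVertex e ≡ meetingVertex e′ → y ≡ y′
    meetingVertex-injective (_ , (u≢u₂ , _ , _ , v≢v₂) , w , _ , _ , (u∈ , v∈) , _)
                            (_ , _ , .w , _ , _ , (u∈′ , v∈′) , _) refl =
      cong₂ _,_ (⟪a,b,w⟫∈H⇒b-unique u∈ u∈′ u≢u₂) (⟪a,b,w⟫∈H⇒b-unique v∈ v∈′ v≢v₂)

    colouredLinks : Subset n
    colouredLinks = ⋃[ S ] (λ i → link u (M i) ∪ link v (M i))

    meetingVertex∈colouredLinks : ∀ {y} (e : InES M S (u , v) y) → meetingVertex e ∈ₛ colouredLinks
    meetingVertex∈colouredLinks (_ , _ , _ , _ , _ , (u∈ , _) , inj₁ i₁∈S) =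
      x∈f[i]⇒x∈⋃[S]f S _ i₁∈S (x∈p∪q⁺ (inj₁ (⟪a,b,c⟫∈M[i]⇒c∈link u∈)))
    meetingVertex∈colouredLinks (_ , _ , _ , _ , _ , (_ , v∈) , inj₂ i₂∈S) =
      x∈f[i]⇒x∈⋃[S]f S _ i₂∈S (x∈p∪q⁺ (inj₂ (⟪a,b,c⟫∈M[i]⇒c∈link v∈)))

    ∣colouredLinks∣≤4∣S∣ : ∣ colouredLinks ∣ ≤ 4 * ∣ S ∣
    ∣colouredLinks∣≤4∣S∣ = ∣⋃[S]f∣≤m*∣S∣ 4 S _ λ i →
      ≤-trans (∣p∪q∣≤∣p∣+∣q∣ (link u (M i)) (link v (M i)))
              (+-mono-≤ (∣link∣≤2 u (tabulate (triple i _))) (∣link∣≤2 v (tabulate (triple i _))))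

claim2p4 : (k n : ℕ) (δ : ℚ) → 0ℚ <ℚ δ → δ <ℚ 1ℚ →
    (C : (Fin k → Sign) → (Fin n → Sign)) (M : Fin k → List (Subset n)) →
    IsStrongLDC k n δ C M →
    (x : Fin n × Fin n) → IsSigVertex x → (S : Subset k) →
    (es : List (Fin n × Fin n)) → Unique es → All (InES M S x) es →
    length es ≤ 4 * ∣ S ∣
claim2p4 k n δ _ _ C M ldc (u , v) _ S es unique edges =
  ≤-trans (Unique⇒length≤∣labels∣ (meetingVertex u v S) (meetingVertex-injective u v S)
                                   (colouredLinks u v S) unique edges (λ _ → meetingVertex∈colouredLinks u v S))
          (∣colouredLinks∣≤4∣S∣ u v S)
  where open StrongLDC ldc
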